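{- Let $\mathsf{AP}$ be a finite set of atomic propositions. For every $\varphi\in\mathsf{LTL}_{\hat{\mathsf{F}},\land,\lor,\top,\bot}[\mathsf{AP}]$ and all ordinal words $w,w'$: if $w\models\varphi$ and $w\leq_{\mathrm{hom}}w'$, then $w'\models\varphi$.
   Context: Words: for a countable ordinal $\alpha$, an $\alpha$-word is a function $w:\alpha\to\mathcal{P}(\mathsf{AP})$; $|w|=\alpha$; for $\beta<|w|$, $w[\beta..]$ is the suffix $w'$ with $w'[\gamma]=w[\beta+\gamma]$ (of length the unique $\gamma_0$ with $\beta+\gamma_0=|w|$). Semantics: $w\models\top$ always, $w\not\models\bot$; $w\models p$ iff $p\in w[0]$; $\land,\lor$ as usual; $\hat{\mathsf{F}}\varphi$ abbreviates $\mathsf{X}\mathsf{F}\varphi$, where $w\models\mathsf{X}\psi$ iff $|w|>1$ and $w[1..]\models\psi$, and $w\models\mathsf{F}\psi$ iff there is $\alpha<|w|$ with $w[\alpha..]\models\psi$. $\mathsf{LTL}_{\hat{\mathsf{F}},\land,\lor,\top,\bot}[\mathsf{AP}]$ is the set of formulas built from atomic propositions of $\mathsf{AP}$ using only $\hat{\mathsf{F}},\land,\lor,\top,\bot$. Homomorphism: a homomorphism from an $\alpha$-word $w$ to a $\beta$-word $w'$ is a function $h:\alpha\to\beta$ such that (1) $h(0)=0$, (2) $w[i]\subseteq w'[h(i)]$ for all $i<\alpha$, and (3) $h(i)<h(j)$ for all $i<j<\alpha$. We write $w\leq_{\mathrm{hom}}w'$ if such a homomorphism exists. -}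

module Defs where

open import Data.Nat using (ℕ)
open import Data.Fin using (Fin)
open import Data.Fin.Subset using (Subset; _∈_; _⊆_)
open import Data.Product using (Σ; _×_; ∃)
open import Data.Sum using (_⊎_)
open import Data.Unit using () renaming (⊤ to Unit)
open import Data.Empty using () renaming (⊥ to Empty)
open import Relation.Nullary using (¬_)
open import Relation.Binary.PropositionalEquality using (_≡_)
open import Function.Definitions using (Injective)

data Formula (n : ℕ) : Set where
  ⊤ᶠ ⊥ᶠ : Formula n
  atom  : Fin n → Formula n
  _∧ᶠ_ _∨ᶠ_ : Formula n → Formula n → Formula n
  F̂     : Formula n → Formula n

-- A countable-ordinal word: a countable well-ordered set of positions
-- (linear strict order in which every nonempty subset has a least element),
-- labelled by subsets of AP.  An α-word is such a word whose positions have
-- order type α; all notions below are invariant under order isomorphism.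
record Word (n : ℕ) : Set₁ where
  field
    Pos       : Set
    _<_       : Pos → Pos → Set
    irrefl    : ∀ x → ¬ (x < x)
    trans     : ∀ {x y z} → x < y → y < z → x < z
    trichot   : ∀ x y → x < y ⊎ (x ≡ y ⊎ y < x)
    wellOrder : (P : Pos → Set) → ∃ P → Σ Pos (λ z → P z × (∀ y → P y → ¬ (y < z)))
    code      : Pos → ℕ
    code-inj  : Injective _≡_ _≡_ code
    label     : Pos → Subset n

open Word public

IsMinIn : ∀ {n} (w : Word n) → (Pos w → Set) → Pos w → Set
IsMinIn w S z = S z × (∀ y → S y → ¬ (_<_ w y z))

-- A suffix w[β..] of w is represented by the upward closed set
-- S of positions of w it consists of (S = everything for w itself,
-- S = {x | β ≤ x} for w[β..]); its γ-th position is the γ-th element of S.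
-- Sat w S φ  means  (the subword of w on S) ⊨ φ.
Sat : ∀ {n} (w : Word n) → (Pos w → Set) → Formula n → Set
Sat w S ⊤ᶠ = Unit
Sat w S ⊥ᶠ = Empty
Sat w S (atom p) = Σ (Pos w) λ z → IsMinIn w S z × (p ∈ label w z)
Sat w S (φ ∧ᶠ ψ) = Sat w S φ × Sat w S ψ
Sat w S (φ ∨ᶠ ψ) = Sat w S φ ⊎ Sat w S ψ
-- F̂ φ = X F φ :  |w| > 1 (there is a position 0 and a position 1 of the
-- subword), and w[1..] ⊨ F φ, i.e. some suffix w[1..][γ..] satisfies φ.
Sat w S (F̂ φ) =
  Σ (Pos w) λ z → IsMinIn w S z ×
  Σ (Pos w) λ s → IsMinIn w (λ x → S x × _<_ w z x) s ×
  Σ (Pos w) λ g → (S g × ¬ (_<_ w g s)) ×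
  Sat w (λ x → S x × ¬ (_<_ w x g)) φ

_⊨_ : ∀ {n} → Word n → Formula n → Set
w ⊨ φ = Sat w (λ _ → Unit) φ

record Hom {n} (w w' : Word n) : Set where
  field
    h       : Pos w → Pos w'
    h-zero  : ∀ z → IsMinIn w (λ _ → Unit) z → IsMinIn w' (λ _ → Unit) (h z)
    h-label : ∀ i → label w i ⊆ label w' (h i)
    h-mono  : ∀ {i j} → _<_ w i j → _<_ w' (h i) (h j)

_≤hom_ : ∀ {n} → Word n → Word n → Set
w ≤hom w' = Hom w w'

{-# OPTIONS --safe #-}
module Submission where

open import Defs
open import Data.Nat using (ℕ)
open import Data.Product using (_×_; _,_)
open import Data.Sum using (inj₁; inj₂)
open import Data.Unit using (⊤; tt)
open import Data.Empty using (⊥-elim)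
open import Relation.Nullary using (¬_)
open import Relation.Binary.PropositionalEquality using (_≡_; refl)

-- Induction on φ, generalised to suffixes: if h maps the suffix S of w into
-- the suffix S' of w' and sends the first position of S to that of S', then
-- every formula true on S is true on S'.  For F̂, a witness suffix of w starting
-- at g yields the suffix of w' starting at h g; it lies beyond the second
-- position of S' because h g > h 0, and since h reflects the order it again
-- corresponds to the suffix at g in this sense.

module _ {n : ℕ} (w : Word n) where

  after : (Pos w → Set) → Pos w → Pos w → Set
  after S z x = S x × _<_ w z x

  suffixFrom : (Pos w → Set) → Pos w → Pos w → Set
  suffixFrom S g x = S x × ¬ (_<_ w x g)

  <-≮-trans : ∀ {x y z} → _<_ w x y → ¬ (_<_ w z y) → _<_ w x z
  <-≮-trans {x} {y} {z} x<y z≮y with trichot w x z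
  ... | inj₁ x<z         = x<z
  ... | inj₂ (inj₁ refl) = ⊥-elim (z≮y x<y)
  ... | inj₂ (inj₂ z<x)  = ⊥-elim (z≮y (trans w z<x x<y))

  isMinIn-suffixFrom : ∀ {S g} → S g → IsMinIn w (suffixFrom S g) g
  isMinIn-suffixFrom g∈S = (g∈S , irrefl w _) , λ _ (_ , y≮g) → y≮g

  isMinIn-suffixFrom⇒≡ : ∀ {S g m} → S g → IsMinIn w (suffixFrom S g) m → m ≡ g
  isMinIn-suffixFrom⇒≡ {g = g} {m} g∈S ((_ , m≮g) , m-least) with trichot w m g
  ... | inj₁ m<g         = ⊥-elim (m≮g m<g)
  ... | inj₂ (inj₁ m≡g)  = m≡g
  ... | inj₂ (inj₂ g<m)  = ⊥-elim (m-least g (g∈S , irrefl w g) g<m)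

module _ {n : ℕ} {w w' : Word n} (H : w ≤hom w') where
  open Hom H

  h-reflects-< : ∀ {x y} → _<_ w' (h x) (h y) → _<_ w x y
  h-reflects-< {x} {y} hx<hy with trichot w x y
  ... | inj₁ x<y         = x<y
  ... | inj₂ (inj₁ refl) = ⊥-elim (irrefl w' _ hx<hy)
  ... | inj₂ (inj₂ y<x)  = ⊥-elim (irrefl w' _ (trans w' hx<hy (h-mono y<x)))

  record Tracks (S : Pos w → Set) (S' : Pos w' → Set) : Set where
    field
      maps-into  : ∀ {x} → S x → S' (h x)
      maps-least : ∀ {z} → IsMinIn w S z → IsMinIn w' S' (h z)

  open Tracks

  tracks-suffixFrom : ∀ {S S' g} → Tracks S S' → S g
                    → Tracks (suffixFrom w S g) (suffixFrom w' S' (h g))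
  tracks-suffixFrom T g∈S .maps-into (x∈S , x≮g) =
    maps-into T x∈S , λ hx<hg → x≮g (h-reflects-< hx<hg)
  tracks-suffixFrom T g∈S .maps-least m-least
    with refl ← isMinIn-suffixFrom⇒≡ w g∈S m-least =
    isMinIn-suffixFrom w' (maps-into T g∈S)

  Sat-transport : ∀ {S S'} (φ : Formula n) → Tracks S S' → Sat w S φ → Sat w' S' φ
  Sat-transport ⊤ᶠ       T _ = tt
  Sat-transport ⊥ᶠ       T ()
  Sat-transport (atom p) T (z , z-least , p∈z) = h z , maps-least T z-least , h-label z p∈z
  Sat-transport (φ ∧ᶠ ψ) T (sφ , sψ) = Sat-transport φ T sφ , Sat-transport ψ T sψ
  Sat-transport (φ ∨ᶠ ψ) T (inj₁ sφ) = inj₁ (Sat-transport φ T sφ)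
  Sat-transport (φ ∨ᶠ ψ) T (inj₂ sψ) = inj₂ (Sat-transport ψ T sψ)
  Sat-transport {S' = S'} (F̂ φ) T
    (z , z-least , s , ((s∈S , z<s) , _) , g , (g∈S , g≮s) , sφ)
    with s' , s'-least@(_ , s'-below) ← wellOrder w' (after w' S' (h z))
                                          (h s , maps-into T s∈S , h-mono z<s) =
    h z , maps-least T z-least , s' , s'-least ,
    h g , (maps-into T g∈S , s'-below (h g) (maps-into T g∈S , h-mono z<g)) ,
    Sat-transport φ (tracks-suffixFrom T g∈S) sφ
    where
    z<g : _<_ w z g
    z<g = <-≮-trans w z<s g≮s

lemma21 : (n : ℕ) (φ : Formula n) (w w' : Word n) → w ⊨ φ → w ≤hom w' → w' ⊨ φ
lemma21 n φ w w' w⊨φ H = Sat-transport H φ everything-tracked w⊨φ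
  where
  everything-tracked : Tracks H (λ _ → ⊤) (λ _ → ⊤)
  everything-tracked = record { maps-into = λ _ → tt ; maps-least = Hom.h-zero H _ }
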